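{- In the setting of the context, for every $[a]\in A/\theta_{\mathcal F}$ the set $R_{[a]}$ is an upset of $\langle E_Y,\preceq_Y\rangle$.
   Context: Let $I$ be an index set, $\mathcal F$ an ultrafilter on $I$. For each $i\in I$ let $\langle X_i,\le_i\rangle$ be a nonempty poset, $E_i$ an equivalence relation on $X_i$ with ${\le_i}\subseteq E_i$, $\alpha_i$ an order automorphism with $\alpha_i\subseteq E_i$; order $E_i$ by $(u,v)\preceq_i(x,y)$ iff $x\le_i u$ and $v\le_i y$. Let $\mathbf A_i$ be an algebra (a distributive involutive FL-algebra) and $\varphi_i$ an embedding of $\mathbf A_i$ into the algebra of upsets of $\langle E_i,\preceq_i\rangle$ (so each $\varphi_i(c)$ is an upset of $\langle E_i,\preceq_i\rangle$). Let $\mathbf A=\prod_i\mathbf A_i$ and $\theta_{\mathcal F}$ the congruence $(a,b)\in\theta_{\mathcal F}$ iff $\{i\mid a(i)=b(i)\}\in\mathcal F$. Let $X=\prod_iX_i$, $Y=X/E_{\mathcal F}$ where $(x,y)\in E_{\mathcal F}$ iff $\{i\mid x(i)=y(i)\}\in\mathcal F$; $[x]\le_Y[y]$ iff $\{i\mid x(i)\le_iy(i)\}\in\mathcal F$; $([x],[y])\in E_Y$ iff $\{i\mid(x(i),y(i))\in E_i\}\in\mathcal F$; $([u],[v])\preceq_Y([x],[y])$ iff $[x]\le_Y[u]$ and $[v]\le_Y[y]$. For $[a]\in A/\theta_{\mathcal F}$ define $([x],[y])\in R_{[a]}$ iff $\{i\in I\mid (x(i),y(i))\in\varphi_i(a(i))\}\in\mathcal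 F$. -}

module Defs where

open import Level using (0ℓ)
open import Data.Product using (_×_; _,_; proj₁; proj₂)
open import Data.Sum using (_⊎_)
open import Relation.Nullary using (¬_)
open import Relation.Unary using (Pred; _⊆_; _∩_; ∁; U; ∅)
open import Relation.Binary using (Rel; IsPartialOrder; IsEquivalence)
open import Relation.Binary.PropositionalEquality using (_≡_)

record IsUltrafilter {I : Set} (F : Pred (Pred I 0ℓ) 0ℓ) : Set₁ where
  field
    top    : F U
    upward : ∀ {S T : Pred I 0ℓ} → F S → S ⊆ T → F T
    meet   : ∀ {S T : Pred I 0ℓ} → F S → F T → F (S ∩ T)
    proper : ¬ F ∅
    ultra  : ∀ (S : Pred I 0ℓ) → F S ⊎ F (∁ S)

pairOrder : {X : Set} → Rel X 0ℓ → Rel (X × X) 0ℓ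
pairOrder _≤_ (u , v) (x , y) = (x ≤ u) × (v ≤ y)

record IsUpset {X : Set} (E : Rel X 0ℓ) (_⪯_ : Rel (X × X) 0ℓ)
               (W : Pred (X × X) 0ℓ) : Set where
  field
    sub    : ∀ {x y} → W (x , y) → E x y
    upClos : ∀ {u v x y} → W (u , v) → E x y → (u , v) ⪯ (x , y) → W (x , y)

-- Data attached to one index i: the poset X_i, the equivalence E_i, the
-- automorphism α_i, the algebra A_i (its carrier) and the embedding φ_i.
record Component : Set₁ where
  field
    X              : Set
    _≤_            : Rel X 0ℓ
    isPartialOrder : IsPartialOrder _≡_ _≤_
    nonempty       : X
    E              : Rel X 0ℓ
    isEquivalence  : IsEquivalence E
    ≤⊆E            : ∀ {x y} → x ≤ y → E x y
    α              : X → X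
    α⁻¹            : X → X
    α-invˡ         : ∀ x → α (α⁻¹ x) ≡ x
    α-invʳ         : ∀ x → α⁻¹ (α x) ≡ x
    α-mono         : ∀ {x y} → x ≤ y → α x ≤ α y
    α-refl         : ∀ {x y} → α x ≤ α y → x ≤ y
    α⊆E            : ∀ x → E x (α x)
    A              : Set
    φ              : A → Pred (X × X) 0ℓ
    φ-upset        : ∀ c → IsUpset E (pairOrder _≤_) (φ c)
    φ-injective    : ∀ {c d} → (∀ p → (φ c p → φ d p) × (φ d p → φ c p)) → c ≡ d

module Ultraproduct {I : Set} (F : Pred (Pred I 0ℓ) 0ℓ) (C : I → Component) where
  open Component

  -- X = ∏ X_i ; elements of Y = X/E_F are represented by elements of X.
  Xπ : Set
  Xπ = (i : I) → X (C i)

  -- A = ∏ A_i ; elements of A/θ_F are represented by elements of A.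
  Aπ : Set
  Aπ = (i : I) → A (C i)

  _≤Y_ : Rel Xπ 0ℓ
  x ≤Y y = F (λ i → _≤_ (C i) (x i) (y i))

  EY : Rel Xπ 0ℓ
  EY x y = F (λ i → E (C i) (x i) (y i))

  _⪯Y_ : Rel (Xπ × Xπ) 0ℓ
  _⪯Y_ = pairOrder _≤Y_

  R : Aπ → Pred (Xπ × Xπ) 0ℓ
  R a (x , y) = F (λ i → φ (C i) (a i) (x i , y i))

{-# OPTIONS --safe #-}
module Submission where

open import Defs
open import Level using (0ℓ)
open import Relation.Unary using (Pred; _⊆_; _∩_)
open import Relation.Binary using (Rel)
open import Data.Product using (_×_; _,_)

-- The upset conditions are Horn clauses in the coordinates, so they pass to
-- the ultraproduct using only that F is upward closed and closed under meets.
module _ {I : Set} {F : Pred (Pred I 0ℓ) 0ℓ}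
  (upward : ∀ {S T : Pred I 0ℓ} → F S → S ⊆ T → F T)
  (meet   : ∀ {S T : Pred I 0ℓ} → F S → F T → F (S ∩ T))
  {X : I → Set} (E _≤_ : (i : I) → Rel (X i) 0ℓ) (W : (i : I) → Pred (X i × X i) 0ℓ)
  where

  liftRel : ((i : I) → Rel (X i) 0ℓ) → Rel ((i : I) → X i) 0ℓ
  liftRel S x y = F (λ i → S i (x i) (y i))

  IsUpset-filterProduct :
    (∀ i → IsUpset (E i) (pairOrder (_≤_ i)) (W i)) →
    IsUpset (liftRel E) (pairOrder (liftRel _≤_)) (λ (x , y) → F (λ i → W i (x i , y i)))
  IsUpset-filterProduct upsets = record
    { sub    = λ w → upward w (λ {i} → IsUpset.sub (upsets i))
    ; upClos = λ w e (x≤u , v≤y) →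
        upward (meet (meet w e) (meet x≤u v≤y))
          (λ {i} ((wᵢ , eᵢ) , ≤ᵢ) → IsUpset.upClos (upsets i) wᵢ eᵢ ≤ᵢ)
    }

lemma4p7 : {I : Set} (F : Pred (Pred I 0ℓ) 0ℓ) → IsUltrafilter F →
    (C : I → Component) → (a : Ultraproduct.Aπ F C) →
    IsUpset (Ultraproduct.EY F C) (Ultraproduct._⪯Y_ F C) (Ultraproduct.R F C a)
lemma4p7 F isUltrafilter C a =
  IsUpset-filterProduct upward meet
    (λ i → E (C i)) (λ i → _≤_ (C i)) (λ i → φ (C i) (a i))
    (λ i → φ-upset (C i) (a i))
  where
  open IsUltrafilter isUltrafilter
  open Component
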